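{- Let $1/3 \le \alpha \le 1$, and let $(G, k, p)$ with $G=(V,E)$ be a yes-instance of Max $\alpha$-FCGP. Let $\sigma = v_1, \ldots, v_n$ be an ordering of $V$ with $d(v_1) \ge d(v_2) \ge \cdots \ge d(v_n)$ (ties broken arbitrarily), and for each $j$ let $V_\sigma^j = \{v_1,\ldots,v_j\}$. Let $C$ be the lexicographically smallest solution (with respect to $\sigma$), and let $v_j$ be the last vertex of $C$ in the ordering $\sigma$. Then $C$ is a dominating set of size $k$ of $G[V_\sigma^j]$.
   Context: Graphs are finite, simple and undirected; $d(v)$ denotes the degree of $v$. For vertex sets $X, Y$, $m(X)$ is the number of edges with both endpoints in $X$ and $m(X,Y)$ is the number of edges with one endpoint in $X$ and the other in $Y$. For $S \subseteq V$, $\mathrm{cov}_{\alpha}(S) = (1-\alpha)\cdot m(S) + \alpha \cdot m(S, V \setminus S)$. Max $\alpha$-FCGP: given $G$ and nonnegative integers $k,p$, decide whether there is $S\subseteq V$ with $|S|=k$ and $\mathrm{cov}_\alpha(S)\ge p$; such an $S$ is a solution. Solutions are compared lexicographically by writing each as the increasing sequence of the $\sigma$-indices of its vertices. A set $C$ dominates $G[V_\sigma^j]$ if every vertex of $V_\sigma^j$ is in $C$ or adjacent to a vertex of $C$.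
   Formalization: The parameter α is taken over the rationals with $1/3 \le \alpha \le 1$ rather than over the reals. -}

module Defs where

open import Data.Bool using (Bool; true; false; _∧_; not; if_then_else_)
open import Data.Nat using (ℕ; zero; suc; _+_)
open import Data.Fin using (Fin; _<_)
open import Data.Fin.Properties using (_<?_)
open import Data.List using (List; allFin; filter; map)
open import Data.Nat.ListAction using (sum)
open import Data.Vec using (lookup)
open import Data.Fin.Subset using (Subset; _∈_; _∉_; ∣_∣)
open import Data.Fin.Permutation using (Permutation′; _⟨$⟩ʳ_)
open import Data.Integer using (+_)
open import Data.Rational using (ℚ; _/_; _*_; _-_; 1ℚ)
open import Data.List.Relation.Binary.Lex.Strict using (Lex-≤)
open import Relation.Binary.PropositionalEquality using (_≡_)
open import Relation.Nullary using (¬_)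
open import Relation.Nullary.Decidable using (⌊_⌋)
open import Data.Product using (∃-syntax; _×_)
open import Data.Empty using (⊥)

record Graph (n : ℕ) : Set where
  field
    adj   : Fin n → Fin n → Bool
    sym   : ∀ u v → adj u v ≡ adj v u
    irrefl : ∀ v → adj v v ≡ false
open Graph public

count : ∀ {n} → (Fin n → Bool) → ℕ
count {n} P = sum (map (λ i → if P i then 1 else 0) (allFin n))

mem : ∀ {n} → Fin n → Subset n → Bool
mem i S = lookup S i

deg : ∀ {n} → Graph n → Fin n → ℕ
deg G v = count (λ u → adj G v u)

-- m(S): edges with both endpoints in S (each unordered pair {u,v}, u < v, counted once)
mIn : ∀ {n} → Graph n → Subset n → ℕ
mIn G S = sum (map (λ u → count (λ v → ⌊ u <? v ⌋ ∧ adj G u v ∧ mem u S ∧ mem v S)) (allFin _))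

mCross : ∀ {n} → Graph n → Subset n → ℕ
mCross G S = sum (map (λ u → count (λ v → adj G u v ∧ mem u S ∧ not (mem v S))) (allFin _))

ℕtoℚ : ℕ → ℚ
ℕtoℚ m = (+ m) / 1

cov : ∀ {n} → ℚ → Graph n → Subset n → ℚ
cov α G S = ((1ℚ - α) * ℕtoℚ (mIn G S)) Data.Rational.+ (α * ℕtoℚ (mCross G S))

IsSolution : ∀ {n} → ℚ → Graph n → ℕ → ℕ → Subset n → Set
IsSolution α G k p S = (∣ S ∣ ≡ k) × (ℕtoℚ p Data.Rational.≤ cov α G S)

YesInstance : ∀ {n} → ℚ → Graph n → ℕ → ℕ → Set
YesInstance α G k p = ∃[ S ] IsSolution α G k p S

-- σ-indices of the vertices of S, as an increasing list
-- (σ ⟨$⟩ʳ i is the vertex v_{i+1}; indices are 0-based)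
σIndices : ∀ {n} → Permutation′ n → Subset n → List (Fin n)
σIndices σ S = filter (λ i → mem (σ ⟨$⟩ʳ i) S Data.Bool.≟ true) (allFin _)

_≤lex[_]_ : ∀ {n} → Subset n → Permutation′ n → Subset n → Set
S ≤lex[ σ ] T = Lex-≤ _≡_ _<_ (σIndices σ S) (σIndices σ T)

LexSmallestSolution : ∀ {n} → ℚ → Graph n → ℕ → ℕ → Permutation′ n → Subset n → Set
LexSmallestSolution α G k p σ C =
  IsSolution α G k p C × (∀ S → IsSolution α G k p S → C ≤lex[ σ ] S)

-- the vertex set V_σ^j = {v_1, …, v_j}: vertices σ i with i ≤ j (0-based index j)
InPrefix : ∀ {n} → Permutation′ n → Fin n → Fin n → Set
InPrefix σ j v = ∃[ i ] (i Data.Fin.≤ j × σ ⟨$⟩ʳ i ≡ v)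

Dominates : ∀ {n} → Graph n → Permutation′ n → Fin n → Subset n → Set
Dominates G σ j C =
  ∀ v → InPrefix σ j v → (v ∈ C) Data.Sum.⊎ (∃[ u ] (u ∈ C × adj G v u ≡ true))
  where import Data.Sum

DominatingSetOfSize : ∀ {n} → Graph n → Permutation′ n → Fin n → Subset n → ℕ → Set
DominatingSetOfSize G σ j C k =
  (∀ v → v ∈ C → InPrefix σ j v) × Dominates G σ j C × (∣ C ∣ ≡ k)

module Submission where

-- Suppose some v = σ i with i ≤ j lies outside C and has no neighbour in C, and let
-- w = σ j. With R = C ∖ {w}, inserting a vertex x ∉ R raises m(R) by d_R(x) and
-- m(R, V ∖ R) by d(x) − 2 d_R(x). Since d_R(v) = 0 and d(v) ≥ d(w), the set
-- S = R ∪ {v} has m(S) = m(C) − a and m(S, V ∖ S) ≥ m(C, V ∖ C) + 2a, where a = d_R(w),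
-- so cov_α(S) − cov_α(C) ≥ (3α − 1) a ≥ 0. Hence S is a solution of size k; it agrees
-- with C before position i and contains σ i while C does not, so S precedes C
-- lexicographically, a contradiction.

open import Defs hiding (sym; irrefl)
open Graph using () renaming (sym to adj-sym; irrefl to adj-irrefl)
open import Data.Nat using (ℕ; zero; suc; _+_; _∸_; _≤_; s≤s; z≤n)
import Data.Nat.Properties as ℕ
import Data.Nat.ListAction as List
open import Data.Fin using (Fin; zero; suc; _<_; punchIn)
import Data.Fin
import Data.Fin.Properties as Fin
open import Data.Fin.Properties using (_≟_; _<?_; any?)
open import Data.Fin.Subset using (Subset; _∈_; ∣_∣)
open import Data.Fin.Permutation using (Permutation′; _⟨$⟩ʳ_; _⟨$⟩ˡ_; inverseʳ)
open import Data.Integer using (+_)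
import Data.Integer as ℤ
import Data.Integer.Properties as ℤ
open import Data.Rational using (ℚ; _/_; 1ℚ)
import Data.Rational
import Data.Rational as ℚ
import Data.Rational.Properties as ℚ
open import Data.Rational.Solver using (module +-*-Solver)
open import Data.Nat.Coprimality using (1-coprimeTo) renaming (sym to coprime-sym)
open import Data.Bool using (Bool; true; false; if_then_else_; _∧_; not)
import Data.Bool as Bool
open import Data.Bool.Properties using (∧-zeroʳ; ∧-identityʳ; ¬-not)
open import Data.List using (List; _∷_; map; filter; tabulate; allFin)
open import Data.List.Properties using (map-tabulate)
open import Data.List.Membership.Propositional using () renaming (_∈_ to _∈ₗ_)
open import Data.List.Membership.Propositional.Properties using (∈-filter⁺; ∈-allFin)
open import Data.List.Relation.Binary.Lex.Core using (Lex-<; Lex-≤; base; halt; this; next)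
open import Data.Vec using (_[_]≔_)
import Data.Vec as Vec
open import Data.Vec.Properties
  using (lookup∘update; lookup∘update′; []≔-idempotent; []≔-lookup; []=⇒lookup; lookup⇒[]=)
open import Data.Product using (_,_; _×_; ∃-syntax; proj₁; proj₂)
open import Data.Sum using (_⊎_; inj₁; inj₂)
open import Function using (_∘_; id)
open import Function.Bundles using (Injection)
open import Function.Properties.Inverse using (↔⇒↣)
open import Relation.Binary.Definitions using (Asymmetric; tri<; tri≈; tri>)
open import Relation.Binary.PropositionalEquality
open import Relation.Nullary using (¬_; Dec; yes; no; ⌊_⌋; contradiction)
open import Relation.Nullary.Decidable using (dec-true; dec-false; isYes≗does; _×-dec_)

open import Algebra.Properties.CommutativeMonoid.Sum ℕ.+-0-commutativeMonoid
  using (sum-syntax; sum-cong-≗; sum-replicate-zero; sum-remove; ∑-distrib-+)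

𝟙 : Bool → ℕ
𝟙 b = if b then 1 else 0

sum-map-allFin : ∀ {n} (f : Fin n → ℕ) → List.sum (map f (allFin n)) ≡ ∑[ i < n ] f i
sum-map-allFin f = trans (cong List.sum (map-tabulate id f)) (sum-tabulate f)
  where
  sum-tabulate : ∀ {m} (g : Fin m → ℕ) → List.sum (tabulate g) ≡ ∑[ i < m ] g i
  sum-tabulate {zero}  g = refl
  sum-tabulate {suc m} g = cong (_+_ (g zero)) (sum-tabulate (g ∘ suc))

count≡∑ : ∀ {n} (P : Fin n → Bool) → count P ≡ ∑[ i < n ] 𝟙 (P i)
count≡∑ P = sum-map-allFin (𝟙 ∘ P)

count-cong : ∀ {n} {P Q : Fin n → Bool} → (∀ i → P i ≡ Q i) → count P ≡ count Q
count-cong {P = P} {Q} P≗Q =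
  trans (count≡∑ P) (trans (sum-cong-≗ (cong 𝟙 ∘ P≗Q)) (sym (count≡∑ Q)))

∑-zero : ∀ {n} {f : Fin n → ℕ} → (∀ i → f i ≡ 0) → ∑[ i < n ] f i ≡ 0
∑-zero {n} f≗0 = trans (sum-cong-≗ f≗0) (sum-replicate-zero n)

⌊⌋-yes : ∀ {a} {A : Set a} (a? : Dec A) → A → ⌊ a? ⌋ ≡ true
⌊⌋-yes a? a = trans (isYes≗does a?) (dec-true a? a)

⌊⌋-no : ∀ {a} {A : Set a} (a? : Dec A) → ¬ A → ⌊ a? ⌋ ≡ false
⌊⌋-no a? ¬a = trans (isYes≗does a?) (dec-false a? ¬a)

δ : ∀ {n} → Fin n → ℕ → Fin n → ℕ
δ x c i = if ⌊ i ≟ x ⌋ then c else 0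

∑-δ : ∀ {n} (x : Fin n) c → ∑[ i < n ] δ x c i ≡ c
∑-δ {suc n} x c = begin
  ∑[ i < suc n ] δ x c i                     ≡⟨ sum-remove {i = x} (δ x c) ⟩
  δ x c x + ∑[ i < n ] δ x c (punchIn x i)   ≡⟨ cong₂ _+_ δ-diag (∑-zero (δ-off ∘ Fin.punchInᵢ≢i x)) ⟩
  c + 0                                      ≡⟨ ℕ.+-identityʳ c ⟩
  c                                          ∎
  where
  open ≡-Reasoning
  δ-diag : δ x c x ≡ c
  δ-diag rewrite ⌊⌋-yes (x ≟ x) refl = refl
  δ-off : ∀ {i} → i ≢ x → δ x c i ≡ 0
  δ-off {i} i≢x rewrite ⌊⌋-no (i ≟ x) i≢x = refl

∑-+-δ : ∀ {n} (f : Fin n → ℕ) (x : Fin n) c → ∑[ i < n ] (f i + δ x c i) ≡ ∑[ i < n ] f i + c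
∑-+-δ {n} f x c = trans (∑-distrib-+ f (δ x c)) (cong (_+_ (∑[ i < n ] f i)) (∑-δ x c))

𝟙-∧-true : ∀ a b c → 𝟙 (a ∧ b ∧ c ∧ true) ≡ 𝟙 (a ∧ b ∧ c ∧ false) + 𝟙 (a ∧ b ∧ c)
𝟙-∧-true a b c rewrite ∧-identityʳ c | ∧-zeroʳ c | ∧-zeroʳ b | ∧-zeroʳ a = refl

𝟙-∧-not+𝟙-∧ : ∀ a b → 𝟙 (a ∧ not b) + 𝟙 (a ∧ b) ≡ 𝟙 a
𝟙-∧-not+𝟙-∧ false b     = refl
𝟙-∧-not+𝟙-∧ true  false = refl
𝟙-∧-not+𝟙-∧ true  true  = refl

⌊x<?x⌋ : ∀ {n} (x : Fin n) → ⌊ x <? x ⌋ ≡ false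
⌊x<?x⌋ x = ⌊⌋-no (x <? x) (Fin.<-irrefl refl)

-- Inserting a vertex

insert : ∀ {n} → Fin n → Subset n → Subset n
insert x T = T [ x ]≔ true

mem-insert-≡ : ∀ {n} (x : Fin n) T → mem x (insert x T) ≡ true
mem-insert-≡ x T = lookup∘update x T true

mem-insert-≢ : ∀ {n} {x y : Fin n} T → y ≢ x → mem y (insert x T) ≡ mem y T
mem-insert-≢ T y≢x = lookup∘update′ y≢x T true

∣insert∣ : ∀ {n} (x : Fin n) T → mem x T ≡ false → ∣ insert x T ∣ ≡ suc ∣ T ∣
∣insert∣ zero    (false Vec.∷ T) x∉T = refl
∣insert∣ (suc x) (true  Vec.∷ T) x∉T = cong suc (∣insert∣ x T x∉T)
∣insert∣ (suc x) (false Vec.∷ T) x∉T = ∣insert∣ x T x∉T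

degIn : ∀ {n} → Graph n → Subset n → Fin n → ℕ
degIn G T x = count (λ y → adj G x y ∧ mem y T)

degIn≡0 : ∀ {n} (G : Graph n) T {x} → (∀ y → mem y T ≡ true → adj G x y ≡ false) → degIn G T x ≡ 0
degIn≡0 G T {x} no-nbr = trans (count≡∑ (λ y → adj G x y ∧ mem y T)) (∑-zero term)
  where
  term : ∀ y → 𝟙 (adj G x y ∧ mem y T) ≡ 0
  term y with mem y T in y∈T
  ... | true  rewrite no-nbr y y∈T = refl
  ... | false rewrite ∧-zeroʳ (adj G x y) = refl

-- mIn G T and mCross G T are, definitionally, sums of these rows over u.
rowIn : ∀ {n} → Graph n → Subset n → Fin n → ℕ
rowIn G T u = count (λ v → ⌊ u <? v ⌋ ∧ adj G u v ∧ mem u T ∧ mem v T)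

rowCross : ∀ {n} → Graph n → Subset n → Fin n → ℕ
rowCross G T u = count (λ v → adj G u v ∧ mem u T ∧ not (mem v T))

rowIn≡∑ : ∀ {n} (G : Graph n) T u →
  rowIn G T u ≡ ∑[ v < n ] 𝟙 (⌊ u <? v ⌋ ∧ adj G u v ∧ mem u T ∧ mem v T)
rowIn≡∑ G T u = count≡∑ (λ v → ⌊ u <? v ⌋ ∧ adj G u v ∧ mem u T ∧ mem v T)

rowCross≡∑ : ∀ {n} (G : Graph n) T u →
  rowCross G T u ≡ ∑[ v < n ] 𝟙 (adj G u v ∧ mem u T ∧ not (mem v T))
rowCross≡∑ G T u = count≡∑ (λ v → adj G u v ∧ mem u T ∧ not (mem v T))

module _ {n} (G : Graph n) where

  rowIn-∉ : ∀ T {u} → mem u T ≡ false → rowIn G T u ≡ 0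
  rowIn-∉ T {u} u∉T = trans (rowIn≡∑ G T u) (∑-zero term)
    where
    term : ∀ v → 𝟙 (⌊ u <? v ⌋ ∧ adj G u v ∧ mem u T ∧ mem v T) ≡ 0
    term v rewrite u∉T | ∧-zeroʳ (adj G u v) | ∧-zeroʳ ⌊ u <? v ⌋ = refl

  rowCross-∉ : ∀ T {u} → mem u T ≡ false → rowCross G T u ≡ 0
  rowCross-∉ T {u} u∉T = trans (rowCross≡∑ G T u) (∑-zero term)
    where
    term : ∀ v → 𝟙 (adj G u v ∧ mem u T ∧ not (mem v T)) ≡ 0
    term v rewrite u∉T | ∧-zeroʳ (adj G u v) = refl

  module _ (T : Subset n) {x : Fin n} (x∉T : mem x T ≡ false) where

    private
      T⁺ = insert x T

      -- Inserting x adds the edges xv with v ∈ T, counted in row x if x < v and in row v otherwise.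
      above : ℕ
      above = count (λ v → ⌊ x <? v ⌋ ∧ adj G x v ∧ mem v T)

      below : Fin n → ℕ
      below u = 𝟙 (⌊ u <? x ⌋ ∧ adj G u x ∧ mem u T)

      inT : Fin n → ℕ
      inT u = 𝟙 (adj G x u ∧ mem u T)

      rowIn-insert-diag : rowIn G T⁺ x ≡ above
      rowIn-insert-diag = count-cong term
        where
        term : ∀ v → ⌊ x <? v ⌋ ∧ adj G x v ∧ mem x T⁺ ∧ mem v T⁺
                   ≡ ⌊ x <? v ⌋ ∧ adj G x v ∧ mem v T
        term v rewrite mem-insert-≡ x T with v ≟ x
        ... | yes refl rewrite ⌊x<?x⌋ v = refl
        ... | no v≢x rewrite mem-insert-≢ T v≢x = refl

      rowIn-insert-off : ∀ {u} → u ≢ x → rowIn G T⁺ u ≡ rowIn G T u + below u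
      rowIn-insert-off {u} u≢x = begin
        rowIn G T⁺ u                                             ≡⟨ rowIn≡∑ G T⁺ u ⟩
        ∑[ v < n ] 𝟙 (l v ∧ adj G u v ∧ mem u T⁺ ∧ mem v T⁺)      ≡⟨ sum-cong-≗ term ⟩
        ∑[ v < n ] (𝟙 (l v ∧ adj G u v ∧ mem u T ∧ mem v T) + δ x (below u) v)
                                                                 ≡⟨ ∑-+-δ _ x (below u) ⟩
        ∑[ v < n ] 𝟙 (l v ∧ adj G u v ∧ mem u T ∧ mem v T) + below u
                                                                 ≡⟨ cong (_+ below u) (rowIn≡∑ G T u) ⟨
        rowIn G T u + below u                                    ∎
        where
        open ≡-Reasoning
        l : Fin n → Bool
        l v = ⌊ u <? v ⌋
        term : ∀ v → 𝟙 (l v ∧ adj G u v ∧ mem u T⁺ ∧ mem v T⁺)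
                   ≡ 𝟙 (l v ∧ adj G u v ∧ mem u T ∧ mem v T) + δ x (below u) v
        term v rewrite mem-insert-≢ T u≢x with v ≟ x
        ... | yes refl = begin
          𝟙 (l v ∧ adj G u v ∧ mem u T ∧ mem v T⁺)          ≡⟨ cong (λ b → 𝟙 (P b)) (mem-insert-≡ v T) ⟩
          𝟙 (l v ∧ adj G u v ∧ mem u T ∧ true)              ≡⟨ 𝟙-∧-true (l v) (adj G u v) (mem u T) ⟩
          𝟙 (l v ∧ adj G u v ∧ mem u T ∧ false) + below u   ≡⟨ cong (λ b → 𝟙 (P b) + below u) x∉T ⟨
          𝟙 (l v ∧ adj G u v ∧ mem u T ∧ mem v T) + below u ∎
          where P = λ b → l v ∧ adj G u v ∧ mem u T ∧ b
        ... | no v≢x rewrite mem-insert-≢ T v≢x = sym (ℕ.+-identityʳ _)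

      below-diag : below x ≡ 0
      below-diag = cong (λ b → 𝟙 (b ∧ adj G x x ∧ mem x T)) (⌊x<?x⌋ x)

      rowIn-insert : ∀ u → rowIn G T⁺ u ≡ rowIn G T u + δ x above u + below u
      rowIn-insert u with u ≟ x
      ... | yes refl = begin
        rowIn G T⁺ u                  ≡⟨ rowIn-insert-diag ⟩
        above                         ≡⟨ ℕ.+-identityʳ above ⟨
        0 + above + 0                 ≡⟨ cong₂ (λ r b → r + above + b) (rowIn-∉ T x∉T) below-diag ⟨
        rowIn G T u + above + below u ∎
        where open ≡-Reasoning
      ... | no u≢x = trans (rowIn-insert-off u≢x) (cong (_+ below u) (sym (ℕ.+-identityʳ _)))

      above+below≡degIn : above + ∑[ u < n ] below u ≡ degIn G T x
      above+below≡degIn = begin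
        above + ∑[ v < n ] below v
          ≡⟨ cong (_+ ∑[ v < n ] below v) (count≡∑ (λ v → ⌊ x <? v ⌋ ∧ adj G x v ∧ mem v T)) ⟩
        ∑[ v < n ] 𝟙 (⌊ x <? v ⌋ ∧ adj G x v ∧ mem v T) + ∑[ v < n ] below v
          ≡⟨ ∑-distrib-+ _ below ⟨
        ∑[ v < n ] (𝟙 (⌊ x <? v ⌋ ∧ adj G x v ∧ mem v T) + below v)
          ≡⟨ sum-cong-≗ term ⟩
        ∑[ v < n ] 𝟙 (adj G x v ∧ mem v T)
          ≡⟨ count≡∑ (λ v → adj G x v ∧ mem v T) ⟨
        degIn G T x ∎
        where
        open ≡-Reasoning
        term : ∀ v → 𝟙 (⌊ x <? v ⌋ ∧ adj G x v ∧ mem v T) + below v ≡ 𝟙 (adj G x v ∧ mem v T)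
        term v with Fin.<-cmp x v
        ... | tri< x<v _ v≮x rewrite ⌊⌋-yes (x <? v) x<v | ⌊⌋-no (v <? x) v≮x = ℕ.+-identityʳ _
        ... | tri≈ _ refl _  rewrite ⌊x<?x⌋ x | adj-irrefl G x = refl
        ... | tri> x≮v _ v<x rewrite ⌊⌋-no (x <? v) x≮v | ⌊⌋-yes (v <? x) v<x | adj-sym G v x = refl

      rowCross-insert-diag : rowCross G T⁺ x + degIn G T x ≡ deg G x
      rowCross-insert-diag = begin
        rowCross G T⁺ x + degIn G T x
          ≡⟨ cong₂ _+_ (rowCross≡∑ G T⁺ x) (count≡∑ (λ v → adj G x v ∧ mem v T)) ⟩
        ∑[ v < n ] 𝟙 (adj G x v ∧ mem x T⁺ ∧ not (mem v T⁺)) + ∑[ v < n ] inT v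
          ≡⟨ ∑-distrib-+ _ inT ⟨
        ∑[ v < n ] (𝟙 (adj G x v ∧ mem x T⁺ ∧ not (mem v T⁺)) + inT v)
          ≡⟨ sum-cong-≗ term ⟩
        ∑[ v < n ] 𝟙 (adj G x v)
          ≡⟨ count≡∑ (adj G x) ⟨
        deg G x ∎
        where
        open ≡-Reasoning
        term : ∀ v → 𝟙 (adj G x v ∧ mem x T⁺ ∧ not (mem v T⁺)) + inT v ≡ 𝟙 (adj G x v)
        term v rewrite mem-insert-≡ x T with v ≟ x
        ... | yes refl rewrite adj-irrefl G v = refl
        ... | no v≢x rewrite mem-insert-≢ T v≢x = 𝟙-∧-not+𝟙-∧ (adj G x v) (mem v T)

      rowCross-insert-off : ∀ {u} → u ≢ x → rowCross G T⁺ u + inT u ≡ rowCross G T u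
      rowCross-insert-off {u} u≢x = begin
        rowCross G T⁺ u + inT u
          ≡⟨ cong (_+ inT u) (rowCross≡∑ G T⁺ u) ⟩
        ∑[ v < n ] 𝟙 (adj G u v ∧ mem u T⁺ ∧ not (mem v T⁺)) + inT u
          ≡⟨ ∑-+-δ _ x (inT u) ⟨
        ∑[ v < n ] (𝟙 (adj G u v ∧ mem u T⁺ ∧ not (mem v T⁺)) + δ x (inT u) v)
          ≡⟨ sum-cong-≗ term ⟩
        ∑[ v < n ] 𝟙 (adj G u v ∧ mem u T ∧ not (mem v T))
          ≡⟨ rowCross≡∑ G T u ⟨
        rowCross G T u ∎
        where
        open ≡-Reasoning
        term : ∀ v → 𝟙 (adj G u v ∧ mem u T⁺ ∧ not (mem v T⁺)) + δ x (inT u) v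
                   ≡ 𝟙 (adj G u v ∧ mem u T ∧ not (mem v T))
        term v rewrite mem-insert-≢ T u≢x with v ≟ x
        ... | yes refl rewrite mem-insert-≡ v T | x∉T | adj-sym G v u =
          sym (𝟙-∧-true true (adj G u v) (mem u T))
        ... | no v≢x rewrite mem-insert-≢ T v≢x = ℕ.+-identityʳ _

      rowCross-insert : ∀ u → rowCross G T⁺ u + inT u + δ x (degIn G T x) u
                            ≡ rowCross G T u + δ x (deg G x) u
      rowCross-insert u with u ≟ x
      ... | yes refl = begin
        rowCross G T⁺ u + inT u + degIn G T u
          ≡⟨ cong (λ c → rowCross G T⁺ u + 𝟙 (c ∧ mem u T) + degIn G T u) (adj-irrefl G u) ⟩
        rowCross G T⁺ u + 0 + degIn G T u
          ≡⟨ cong (_+ degIn G T u) (ℕ.+-identityʳ _) ⟩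
        rowCross G T⁺ u + degIn G T u
          ≡⟨ rowCross-insert-diag ⟩
        deg G u
          ≡⟨ cong (_+ deg G u) (rowCross-∉ T x∉T) ⟨
        rowCross G T u + deg G u ∎
        where open ≡-Reasoning
      ... | no u≢x = trans (ℕ.+-identityʳ _) (trans (rowCross-insert-off u≢x) (sym (ℕ.+-identityʳ _)))

    mIn-insert : mIn G T⁺ ≡ mIn G T + degIn G T x
    mIn-insert = begin
      mIn G T⁺
        ≡⟨ sum-map-allFin (rowIn G T⁺) ⟩
      ∑[ u < n ] rowIn G T⁺ u
        ≡⟨ sum-cong-≗ rowIn-insert ⟩
      ∑[ u < n ] (rowIn G T u + δ x above u + below u)
        ≡⟨ ∑-distrib-+ _ below ⟩
      ∑[ u < n ] (rowIn G T u + δ x above u) + ∑[ u < n ] below u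
        ≡⟨ cong (_+ ∑[ u < n ] below u) (∑-+-δ (rowIn G T) x above) ⟩
      ∑[ u < n ] rowIn G T u + above + ∑[ u < n ] below u
        ≡⟨ ℕ.+-assoc (∑[ u < n ] rowIn G T u) above _ ⟩
      ∑[ u < n ] rowIn G T u + (above + ∑[ u < n ] below u)
        ≡⟨ cong₂ _+_ (sym (sum-map-allFin (rowIn G T))) above+below≡degIn ⟩
      mIn G T + degIn G T x ∎
      where open ≡-Reasoning

    mCross-insert : mCross G T⁺ + degIn G T x + degIn G T x ≡ mCross G T + deg G x
    mCross-insert = begin
      mCross G T⁺ + degIn G T x + degIn G T x
        ≡⟨ cong (λ m → m + degIn G T x + degIn G T x) (sum-map-allFin (rowCross G T⁺)) ⟩
      ∑[ u < n ] rowCross G T⁺ u + degIn G T x + degIn G T x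
        ≡⟨ cong (λ d → ∑[ u < n ] rowCross G T⁺ u + d + degIn G T x) (count≡∑ (λ v → adj G x v ∧ mem v T)) ⟩
      ∑[ u < n ] rowCross G T⁺ u + ∑[ u < n ] inT u + degIn G T x
        ≡⟨ cong (_+ degIn G T x) (∑-distrib-+ (rowCross G T⁺) inT) ⟨
      ∑[ u < n ] (rowCross G T⁺ u + inT u) + degIn G T x
        ≡⟨ ∑-+-δ _ x (degIn G T x) ⟨
      ∑[ u < n ] (rowCross G T⁺ u + inT u + δ x (degIn G T x) u)
        ≡⟨ sum-cong-≗ rowCross-insert ⟩
      ∑[ u < n ] (rowCross G T u + δ x (deg G x) u)
        ≡⟨ ∑-+-δ (rowCross G T) x (deg G x) ⟩
      ∑[ u < n ] rowCross G T u + deg G x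
        ≡⟨ cong (_+ deg G x) (sum-map-allFin (rowCross G T)) ⟨
      mCross G T + deg G x ∎
      where open ≡-Reasoning

-- Coverage under an exchange

ℕtoℚ≡mkℚ : ∀ k → ℕtoℚ k ≡ ℚ.mkℚ (+ k) 0 (coprime-sym (1-coprimeTo k))
ℕtoℚ≡mkℚ k = ℚ.normalize-coprime (coprime-sym (1-coprimeTo k))

ℕtoℚ-+ : ∀ m n → ℕtoℚ (m + n) ≡ ℕtoℚ m ℚ.+ ℕtoℚ n
ℕtoℚ-+ m n rewrite ℕtoℚ≡mkℚ m | ℕtoℚ≡mkℚ n =
  ℚ./-cong {p₁ = + (m + n)} (sym (cong₂ ℤ._+_ (ℤ.*-identityʳ (+ m)) (ℤ.*-identityʳ (+ n)))) refl

0≤ℕtoℚ : ∀ k → ℚ.0ℚ ℚ.≤ ℕtoℚ k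
0≤ℕtoℚ k = ℚ.nonNegative⁻¹ (ℕtoℚ k) {{ℚ.normalize-nonNeg k 1}}

0≤* : ∀ {p q} → ℚ.0ℚ ℚ.≤ p → ℚ.0ℚ ℚ.≤ q → ℚ.0ℚ ℚ.≤ p ℚ.* q
0≤* {p} {q} 0≤p 0≤q =
  ℚ.nonNegative⁻¹ (p ℚ.* q)
    {{ℚ.nonNeg*nonNeg⇒nonNeg p {{ℚ.nonNegative 0≤p}} q {{ℚ.nonNegative 0≤q}}}}

-- cov α G T is definitionally cov′ α (mIn G T) (mCross G T).
cov′ : ℚ → ℕ → ℕ → ℚ
cov′ α i c = (1ℚ ℚ.- α) ℚ.* ℕtoℚ i ℚ.+ α ℚ.* ℕtoℚ c

cov′-trade : ∀ α → + 1 / 3 ℚ.≤ α → ∀ i a c m → cov′ α (i + a) c ℚ.≤ cov′ α i (c + (a + a + m))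
cov′-trade α ⅓≤α i a c m =
  subst₂ ℚ._≤_ (ℚ.+-identityʳ _) (sym gain)
         (ℚ.+-monoʳ-≤ (cov′ α (i + a) c) (ℚ.+-mono-≤ 0≤[3α-1]a 0≤αm))
  where
  A = ℕtoℚ a
  M = ℕtoℚ m
  3α-1 = α ℚ.+ α ℚ.+ α ℚ.- 1ℚ
  0≤[3α-1]a : ℚ.0ℚ ℚ.≤ 3α-1 ℚ.* A
  0≤[3α-1]a = 0≤* (ℚ.+-monoˡ-≤ (ℚ.- 1ℚ) (ℚ.+-mono-≤ (ℚ.+-mono-≤ ⅓≤α ⅓≤α) ⅓≤α)) (0≤ℕtoℚ a)
  0≤αm : ℚ.0ℚ ℚ.≤ α ℚ.* M
  0≤αm = 0≤* (ℚ.≤-trans (ℚ.nonNegative⁻¹ (+ 1 / 3) {{ℚ.normalize-nonNeg 1 3}}) ⅓≤α) (0≤ℕtoℚ m)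
  gain : cov′ α i (c + (a + a + m)) ≡ cov′ α (i + a) c ℚ.+ (3α-1 ℚ.* A ℚ.+ α ℚ.* M)
  gain rewrite ℕtoℚ-+ i a | ℕtoℚ-+ c (a + a + m) | ℕtoℚ-+ (a + a) m | ℕtoℚ-+ a a =
    solve 5 (λ α I A C M → (con 1ℚ :- α) :* I :+ α :* (C :+ (A :+ A :+ M)) :=
                           ((con 1ℚ :- α) :* (I :+ A) :+ α :* C) :+ ((α :+ α :+ α :- con 1ℚ) :* A :+ α :* M))
            refl α (ℕtoℚ i) A (ℕtoℚ c) M
    where open +-*-Solver

swap : ∀ {n} → Fin n → Fin n → Subset n → Subset n
swap u w C = insert u (C [ w ]≔ false)

mem-swap-≢ : ∀ {n} {u w y : Fin n} C → y ≢ u → y ≢ w → mem y (swap u w C) ≡ mem y C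
mem-swap-≢ {w = w} C y≢u y≢w = trans (mem-insert-≢ (C [ w ]≔ false) y≢u) (lookup∘update′ y≢w C false)

module _ {n} (G : Graph n) (C : Subset n) {u w : Fin n}
         (u∉C : mem u C ≡ false) (w∈C : mem w C ≡ true)
         (u-isolated : ∀ y → mem y C ≡ true → adj G u y ≡ false) where

  private
    R = C [ w ]≔ false
    a = degIn G R w

    u≢w : u ≢ w
    u≢w refl = contradiction (trans (sym u∉C) w∈C) λ ()

    w∉R : mem w R ≡ false
    w∉R = lookup∘update w C false

    u∉R : mem u R ≡ false
    u∉R = trans (lookup∘update′ u≢w C false) u∉C

    C≡insert-w-R : C ≡ insert w R
    C≡insert-w-R = sym (trans ([]≔-idempotent C w) (subst (λ b → C [ w ]≔ b ≡ C) w∈C ([]≔-lookup C w)))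

    degIn-R-u : degIn G R u ≡ 0
    degIn-R-u = degIn≡0 G R u-isolated-R
      where
      u-isolated-R : ∀ y → mem y R ≡ true → adj G u y ≡ false
      u-isolated-R y y∈R with y ≟ w
      ... | yes refl = contradiction (trans (sym w∉R) y∈R) λ ()
      ... | no y≢w   = u-isolated y (trans (sym (lookup∘update′ y≢w C false)) y∈R)

  ∣swap∣ : ∣ swap u w C ∣ ≡ ∣ C ∣
  ∣swap∣ = begin
    ∣ insert u R ∣ ≡⟨ ∣insert∣ u R u∉R ⟩
    suc ∣ R ∣      ≡⟨ ∣insert∣ w R w∉R ⟨
    ∣ insert w R ∣ ≡⟨ cong ∣_∣ C≡insert-w-R ⟨
    ∣ C ∣          ∎
    where open ≡-Reasoning

  module _ (α : ℚ) (⅓≤α : + 1 / 3 ℚ.≤ α) (deg-w≤deg-u : deg G w ≤ deg G u) where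

    private
      m = deg G u ∸ deg G w

      mIn-C : mIn G C ≡ mIn G (swap u w C) + a
      mIn-C = begin
        mIn G C                   ≡⟨ cong (mIn G) C≡insert-w-R ⟩
        mIn G (insert w R)        ≡⟨ mIn-insert G R w∉R ⟩
        mIn G R + a               ≡⟨ cong (_+ a) (ℕ.+-identityʳ (mIn G R)) ⟨
        mIn G R + 0 + a           ≡⟨ cong (λ d → mIn G R + d + a) degIn-R-u ⟨
        mIn G R + degIn G R u + a ≡⟨ cong (_+ a) (mIn-insert G R u∉R) ⟨
        mIn G (insert u R) + a    ∎
        where open ≡-Reasoning

      mCross-swap : mCross G (swap u w C) ≡ mCross G C + (a + a + m)
      mCross-swap = begin
        mCross G (insert u R)                             ≡⟨ ℕ.+-identityʳ _ ⟨
        mCross G (insert u R) + 0                         ≡⟨ ℕ.+-identityʳ _ ⟨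
        mCross G (insert u R) + 0 + 0
          ≡⟨ cong (λ d → mCross G (insert u R) + d + d) degIn-R-u ⟨
        mCross G (insert u R) + degIn G R u + degIn G R u ≡⟨ mCross-insert G R u∉R ⟩
        mCross G R + deg G u                              ≡⟨ cong (_+_ (mCross G R)) (ℕ.m+[n∸m]≡n deg-w≤deg-u) ⟨
        mCross G R + (deg G w + m)                        ≡⟨ ℕ.+-assoc (mCross G R) (deg G w) m ⟨
        mCross G R + deg G w + m                          ≡⟨ cong (_+ m) (mCross-insert G R w∉R) ⟨
        mCross G (insert w R) + a + a + m                 ≡⟨ cong (λ T → mCross G T + a + a + m) C≡insert-w-R ⟨
        mCross G C + a + a + m                            ≡⟨ cong (_+ m) (ℕ.+-assoc (mCross G C) a a) ⟩
        mCross G C + (a + a) + m                          ≡⟨ ℕ.+-assoc (mCross G C) (a + a) m ⟩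
        mCross G C + (a + a + m)                          ∎
        where open ≡-Reasoning

    cov-swap : cov α G C ℚ.≤ cov α G (swap u w C)
    cov-swap = subst₂ ℚ._≤_ (cong (λ i → cov′ α i (mCross G C)) (sym mIn-C))
                            (cong (cov′ α (mIn G (swap u w C))) (sym mCross-swap))
                            (cov′-trade α ⅓≤α (mIn G (swap u w C)) a (mCross G C) m)

-- Lexicographic comparison of index lists

module _ {a ℓ} {A : Set a} {_≺_ : A → A → Set ℓ} (≺-asym : Asymmetric _≺_) where

  Lex-≤⇒≯ : ∀ {xs ys} → Lex-≤ _≡_ _≺_ xs ys → ¬ Lex-< _≡_ _≺_ ys xs
  Lex-≤⇒≯ (base _)          (base ())
  Lex-≤⇒≯ (this x≺y)        (this y≺x)        = ≺-asym x≺y y≺x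
  Lex-≤⇒≯ (this x≺x)        (next refl _)     = ≺-asym x≺x x≺x
  Lex-≤⇒≯ (next refl _)     (this x≺x)        = ≺-asym x≺x x≺x
  Lex-≤⇒≯ (next refl xs≤ys) (next refl ys<xs) = Lex-≤⇒≯ xs≤ys ys<xs

Lex-<-map-suc : ∀ {n} {xs ys : List (Fin n)} → Lex-< _≡_ _<_ xs ys → Lex-< _≡_ _<_ (map suc xs) (map suc ys)
Lex-<-map-suc halt            = halt
Lex-<-map-suc (this x<y)      = this (s≤s x<y)
Lex-<-map-suc (next refl x<y) = next refl (Lex-<-map-suc x<y)

trues : ∀ {n} → (Fin n → Bool) → List (Fin n)
trues {n} f = filter (λ k → f k Bool.≟ true) (allFin n)

filter-tabulate-suc : ∀ {m n} (f : Fin (suc n) → Bool) (g : Fin m → Fin n) →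
  filter (λ k → f k Bool.≟ true) (tabulate (suc ∘ g))
    ≡ map suc (filter (λ k → f (suc k) Bool.≟ true) (tabulate g))
filter-tabulate-suc {zero}  f g = refl
filter-tabulate-suc {suc m} f g with f (suc (g zero))
... | true  = cong (suc (g zero) ∷_) (filter-tabulate-suc f (g ∘ suc))
... | false = filter-tabulate-suc f (g ∘ suc)

trues-suc : ∀ {n} (f : Fin (suc n) → Bool) →
  trues f ≡ (if f zero then zero ∷ map suc (trues (f ∘ suc)) else map suc (trues (f ∘ suc)))
trues-suc f with f zero
... | true  = cong (zero ∷_) (filter-tabulate-suc f id)
... | false = filter-tabulate-suc f id

zero∷<map-suc : ∀ {n} {xs : List (Fin (suc n))} {ys : List (Fin n)} {y} → y ∈ₗ ys →
  Lex-< _≡_ _<_ (zero ∷ xs) (map suc ys)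
zero∷<map-suc {ys = _ ∷ _} _ = this (s≤s z≤n)

trues-<-lex : ∀ {n} (f h : Fin n → Bool) {i j} → (∀ {k} → k < i → f k ≡ h k) →
  f i ≡ true → h i ≡ false → i < j → h j ≡ true → Lex-< _≡_ _<_ (trues f) (trues h)
trues-<-lex {suc n} f h {zero} {suc j} _ fi hi _ hj rewrite trues-suc f | trues-suc h | fi | hi =
  zero∷<map-suc (∈-filter⁺ (λ k → h (suc k) Bool.≟ true) (∈-allFin j) hj)
trues-<-lex {suc n} f h {suc i} {suc j} f≡h fi hi (s≤s i<j) hj
  rewrite trues-suc f | trues-suc h | f≡h {zero} (s≤s z≤n)
  with h zero | trues-<-lex (f ∘ suc) (h ∘ suc) (λ k<i → f≡h (s≤s k<i)) fi hi i<j hj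
... | true  | tails = next refl (Lex-<-map-suc tails)
... | false | tails = Lex-<-map-suc tails

Undominated : ∀ {n} → Graph n → Subset n → Fin n → Set
Undominated G C v = mem v C ≡ false × (∀ y → mem y C ≡ true → adj G v y ≡ false)

¬undominated⇒dominated : ∀ {n} (G : Graph n) C v → ¬ Undominated G C v →
  (v ∈ C) ⊎ (∃[ u ] (u ∈ C × adj G v u ≡ true))
¬undominated⇒dominated G C v ¬undom with mem v C in v∈C
... | true  = inj₁ (lookup⇒[]= v C v∈C)
... | false with any? (λ y → (mem y C Bool.≟ true) ×-dec (adj G v y Bool.≟ true))
...   | yes (y , y∈C , vy) = inj₂ (y , lookup⇒[]= y C y∈C , vy)
...   | no ¬nbr = contradiction (refl , λ y y∈C → ¬-not (λ vy → ¬nbr (y , y∈C , vy))) ¬undom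

lexSmallest⇒¬undominated : ∀ {n} α → + 1 / 3 ℚ.≤ α → (G : Graph n) (k p : ℕ) (σ : Permutation′ n) →
  (∀ i i′ → i Data.Fin.≤ i′ → deg G (σ ⟨$⟩ʳ i′) ≤ deg G (σ ⟨$⟩ʳ i)) →
  ∀ {C} → LexSmallestSolution α G k p σ C →
  ∀ {i j} → i Data.Fin.≤ j → σ ⟨$⟩ʳ j ∈ C → ¬ Undominated G C (σ ⟨$⟩ʳ i)
lexSmallest⇒¬undominated α ⅓≤α G k p σ deg-decreasing {C} (C-sol , C-least) {i} {j} i≤j σj∈C
                         (u∉C , u-isolated) =
  Lex-≤⇒≯ Fin.<-asym (C-least S S-sol) S<C
  where
  u = σ ⟨$⟩ʳ i
  w = σ ⟨$⟩ʳ j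
  S = swap u w C
  w∈C = []=⇒lookup σj∈C

  S-sol : IsSolution α G k p S
  S-sol = trans (∣swap∣ G C u∉C w∈C u-isolated) (proj₁ C-sol)
        , ℚ.≤-trans (proj₂ C-sol) (cov-swap G C u∉C w∈C u-isolated α ⅓≤α (deg-decreasing i j i≤j))

  σ-injective : ∀ {x y} → σ ⟨$⟩ʳ x ≡ σ ⟨$⟩ʳ y → x ≡ y
  σ-injective = Injection.injective (↔⇒↣ σ)

  i<j : i < j
  i<j = Fin.≤∧≢⇒< i≤j λ i≡j →
    contradiction (trans (sym u∉C) (trans (cong (λ x → mem (σ ⟨$⟩ʳ x) C) i≡j) w∈C)) λ ()

  S≡C-below-i : ∀ {x} → x < i → mem (σ ⟨$⟩ʳ x) S ≡ mem (σ ⟨$⟩ʳ x) C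
  S≡C-below-i x<i = mem-swap-≢ C (Fin.<⇒≢ x<i ∘ σ-injective) (Fin.<⇒≢ (ℕ.<-≤-trans x<i i≤j) ∘ σ-injective)

  S<C : Lex-< _≡_ _<_ (σIndices σ S) (σIndices σ C)
  S<C = trues-<-lex (λ x → mem (σ ⟨$⟩ʳ x) S) (λ x → mem (σ ⟨$⟩ʳ x) C) S≡C-below-i
                    (mem-insert-≡ u (C [ w ]≔ false)) u∉C i<j w∈C

lemma7 : (α : ℚ) → (+ 1 / 3) Data.Rational.≤ α → α Data.Rational.≤ 1ℚ →
         (n : ℕ) (G : Graph n) (k p : ℕ) → YesInstance α G k p →
         (σ : Permutation′ n) →
         (∀ i i′ → i Data.Fin.≤ i′ → deg G (σ ⟨$⟩ʳ i′) ≤ deg G (σ ⟨$⟩ʳ i)) →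
         (C : Subset n) → LexSmallestSolution α G k p σ C →
         (j : Fin n) → (σ ⟨$⟩ʳ j) ∈ C → (∀ i → (σ ⟨$⟩ʳ i) ∈ C → i Data.Fin.≤ j) →
         DominatingSetOfSize G σ j C k
lemma7 α ⅓≤α _ n G k p _ σ deg-decreasing C C-least j σj∈C σj-last =
  C⊆prefix , dominates , proj₁ (proj₁ C-least)
  where
  C⊆prefix : ∀ v → v ∈ C → InPrefix σ j v
  C⊆prefix v v∈C = σ ⟨$⟩ˡ v , σj-last _ (subst (_∈ C) (sym (inverseʳ σ)) v∈C) , inverseʳ σ

  dominates : Dominates G σ j C
  dominates _ (i , i≤j , refl) =
    ¬undominated⇒dominated G C _
      (lexSmallest⇒¬undominated α ⅓≤α G k p σ deg-decreasing C-least i≤j σj∈C)
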